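{- Let $C$ be a formula in which the free resource variables $x_1,\dots,x_n$ occur only positively, let $\alpha$ be an atom of arity $n$, let $\Phi$ be a constraint set and $A,B$ formulas. If $A\le_\Phi B$, then $A\{C/\alpha(x_1,\dots,x_n)\}\le_\Phi B\{C/\alpha(x_1,\dots,x_n)\}$.
   Context: Resource polynomials: finite sums of finite products $\prod_i\binom{x_i}{n_i}$ (pairwise distinct variables $x_i$, $n_i\in\mathbb{N}$), read as functions of natural-number variables. A constraint is $p\le q$ for resource polynomials $p,q$; $p<q$ abbreviates $p+1\le q$; a constraint set is a finite set of constraints. $\Phi\models c$ means every assignment of naturals to variables satisfying all of $\Phi$ satisfies $c$; $\Phi\models\Psi$ means $\Phi\models c$ for all $c\in\Psi$; $p\sqsubseteq_\Phi q$ means $\Phi\models p\le q$. Formulas: $A::=\alpha(p_1,\dots,p_n)\mid A\otimes A\mid A\multimap A\mid\forall\alpha.A\mid\,!_{x<p}A\mid\forall(x_1,\dots,x_n){:}\Phi.A\mid\exists(x_1,\dots,x_n){:}\Phi.A$, where $\alpha$ ranges over atoms with fixed arities, the $p_i,p$ are resource polynomials, $x\notin FV(p)$, $\Phi$ a constraint set, and (boundedness) for each quantifier formula there are resource polynomials $r_i$ not containing $\overline{x}$ with $\Phi\models\{x_i\le r_i\}_i$. $!_{x<p}$ binds $x$ in its body, first-order quantifiers bind $\overline{x}$ in $\Phi$ and the body, $\forall\alpha$ binds $\alpha$; formulas are taken up to renaming of bound variables. Polarity: variables in $p_1,\dots,p_n$ occur positively in $\alpha(p_1,\dots,p_n)$;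 in a constraint $p\le q$ variables of $p$ are negative and those of $q$ positive; polarity is reversed in the first argument of $\multimap$, in the bound $p$ of $!_{x<p}$, and in the constraint set of $\forall\overline{x}{:}\Phi$; preserved elsewhere. Substitution of a formula for an atom: if $C$ is a formula in which the free variables $x_1,\dots,x_n$ occur only positively, $A\{C/\alpha(x_1,\dots,x_n)\}$ is obtained by replacing every free occurrence $\alpha(p_1,\dots,p_n)$ in $A$ by $C\{p_1/x_1,\dots,p_n/x_n\}$ (capture-avoiding). Order on formulas: $\alpha(\overline{p})\le_\Phi\alpha(\overline{q})$ iff $p_i\sqsubseteq_\Phi q_i$ for all $i$; $A\otimes B\le_\Phi C\otimes D$ iff $A\le_\Phi C$ and $B\le_\Phi D$; $A\multimap B\le_\Phi C\multimap D$ iff $C\le_\Phi A$ and $B\le_\Phi D$; $\forall\alpha.A\le_\Phi\forall\alpha.B$ iff $A\le_\Phi B$; $!_{x<p}A\le_\Phi\,!_{x<q}B$ iff $q\sqsubseteq_\Phi p$, $x\notin FV(\Phi)$, $A\le_{\Phi\cup\{x<q\}}B$; $\forall\overline{x}{:}\Psi.A\le_\Phi\forall\overline{x}{:}\Theta.B$ iff $\Phi\cup\Theta\models\Psi$, $\overline{x}\notin FV(\Phi)$, $A\le_{\Phi\cup\Theta}B$; $\exists\overline{x}{:}\Psi.A\le_\Phi\exists\overline{x}{:}\Theta.B$ iff $\Phi\cup\Psi\models\Theta$, $\overline{x}\notin FV(\Phi)$, $A\le_{\Phi\cup\Psi}B$. -}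

module Defs where

open import Data.Nat using (ℕ; zero; suc; _+_; _*_; _∸_; _≤_; _<ᵇ_; _≡ᵇ_)
open import Data.Nat.Combinatorics using (_C_)
open import Data.Bool using (if_then_else_)
open import Data.List using (List; []; _∷_; [_]; _++_; map; length)
open import Data.List.Relation.Unary.All using (All)
open import Data.List.Relation.Unary.Unique.Propositional using (Unique)
open import Data.List.Relation.Binary.Pointwise using (Pointwise)
open import Data.Maybe using (Maybe; just; nothing)
open import Data.Product using (Σ; _×_; ∃-syntax)
open import Data.Sum using (_⊎_)
open import Data.Unit using (⊤)
open import Data.Empty using (⊥)
open import Relation.Nullary using (¬_)
open import Relation.Binary.PropositionalEquality using (_≡_)

-- A genuine resource polynomial (paper's sense) is one satisfying IsRP
-- below; the larger term syntax is only needed because substitution of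
-- polynomials into polynomials (composition) leaves the normal-form
-- syntax.  Everything semantic (⊨, ⊑) depends only on the denotation.

data Poly : Set where
  var  : ℕ → Poly
  𝟘    : Poly
  𝟙    : Poly
  _⊕_  : Poly → Poly → Poly
  _⊛_  : Poly → Poly → Poly
  bin  : Poly → ℕ → Poly

eval : (ℕ → ℕ) → Poly → ℕ
eval ρ (var x)   = ρ x
eval ρ 𝟘         = 0
eval ρ 𝟙         = 1
eval ρ (p ⊕ q)   = eval ρ p + eval ρ q
eval ρ (p ⊛ q)   = eval ρ p * eval ρ q
eval ρ (bin p k) = eval ρ p C k

data Mono : Poly → List ℕ → Set where
  one : Mono 𝟙 []
  fac : ∀ x k → Mono (bin (var x) k) [ x ]
  mul : ∀ {p q xs ys} → Mono p xs → Mono q ys → Mono (p ⊛ q) (xs ++ ys)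

data IsRP : Poly → Set where
  zero : IsRP 𝟘
  mono : ∀ {p} xs → Mono p xs → Unique xs → IsRP p
  add  : ∀ {p q} → IsRP p → IsRP q → IsRP (p ⊕ q)

Free : ℕ → Poly → Set
Free x (var y)   = x ≡ y
Free x 𝟘         = ⊥
Free x 𝟙         = ⊥
Free x (p ⊕ q)   = Free x p ⊎ Free x q
Free x (p ⊛ q)   = Free x p ⊎ Free x q
Free x (bin p k) = Free x p

psub : (ℕ → Poly) → Poly → Poly
psub σ (var x)   = σ x
psub σ 𝟘         = 𝟘
psub σ 𝟙         = 𝟙
psub σ (p ⊕ q)   = psub σ p ⊕ psub σ q
psub σ (p ⊛ q)   = psub σ p ⊛ psub σ q
psub σ (bin p k) = bin (psub σ p) k

pshift : ℕ → Poly → Poly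
pshift m = psub (λ j → var (m + j))

lift : ℕ → (ℕ → Poly) → ℕ → Poly
lift m σ j = if j <ᵇ m then var j else pshift m (σ (j ∸ m))

record Constraint : Set where
  constructor _≤ᶜ_
  field
    lhs : Poly
    rhs : Poly

_<ᶜ_ : Poly → Poly → Constraint
p <ᶜ q = (p ⊕ 𝟙) ≤ᶜ q

CSet : Set
CSet = List Constraint

Sat : (ℕ → ℕ) → Constraint → Set
Sat ρ (p ≤ᶜ q) = eval ρ p ≤ eval ρ q

_⊨_ : CSet → Constraint → Set
Φ ⊨ c = ∀ (ρ : ℕ → ℕ) → All (Sat ρ) Φ → Sat ρ c

_⊨*_ : CSet → CSet → Set
Φ ⊨* Ψ = All (Φ ⊨_) Ψ

_⊑[_]_ : Poly → CSet → Poly → Set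
p ⊑[ Φ ] q = Φ ⊨ (p ≤ᶜ q)

csub : (ℕ → Poly) → Constraint → Constraint
csub σ (p ≤ᶜ q) = psub σ p ≤ᶜ psub σ q

csetsub : (ℕ → Poly) → CSet → CSet
csetsub σ = map (csub σ)

cshift : ℕ → CSet → CSet
cshift m = csetsub (λ j → var (m + j))

RPc : Constraint → Set
RPc (p ≤ᶜ q) = IsRP p × IsRP q

-- Resource variables and atom variables are de Bruijn
-- indices (formulas are thus identified up to renaming of bound
-- variables).
--   at a ps      : α(p1,…,pn), α the atom with de Bruijn index a
--   all k A      : ∀α.A, α an atom of arity k (index 0 in A)
--   bang p A     : !_{x<p} A, x is resource index 0 in A (p lives outside)
--   fa m Φ A     : ∀(x_1..x_m):Φ.A, x_i are indices 0..m-1 in Φ and A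
--   ex m Φ A     : ∃(x_1..x_m):Φ.A

infixr 20 _⊗_
infixr 15 _⊸_
infix 4 _≤[_]_

data Form : Set where
  at   : ℕ → List Poly → Form
  _⊗_  : Form → Form → Form
  _⊸_  : Form → Form → Form
  all  : ℕ → Form → Form
  bang : Poly → Form → Form
  fa   : ℕ → CSet → Form → Form
  ex   : ℕ → CSet → Form → Form

fsub : (ℕ → Poly) → Form → Form
fsub σ (at a ps)   = at a (map (psub σ) ps)
fsub σ (A ⊗ B)     = fsub σ A ⊗ fsub σ B
fsub σ (A ⊸ B)     = fsub σ A ⊸ fsub σ B
fsub σ (all k A)   = all k (fsub σ A)
fsub σ (bang p A)  = bang (psub σ p) (fsub (lift 1 σ) A)
fsub σ (fa m Φ A)  = fa m (csetsub (lift m σ) Φ) (fsub (lift m σ) A)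
fsub σ (ex m Φ A)  = ex m (csetsub (lift m σ) Φ) (fsub (lift m σ) A)

aext : (ℕ → ℕ) → ℕ → ℕ
aext ρ zero    = zero
aext ρ (suc i) = suc (ρ i)

aren : (ℕ → ℕ) → Form → Form
aren ρ (at a ps)  = at (ρ a) ps
aren ρ (A ⊗ B)    = aren ρ A ⊗ aren ρ B
aren ρ (A ⊸ B)    = aren ρ A ⊸ aren ρ B
aren ρ (all k A)  = all k (aren (aext ρ) A)
aren ρ (bang p A) = bang p (aren ρ A)
aren ρ (fa m Φ A) = fa m Φ (aren ρ A)
aren ρ (ex m Φ A) = ex m Φ (aren ρ A)

lookupD : List Poly → ℕ → Poly
lookupD []       _       = 𝟘
lookupD (p ∷ ps) zero    = p
lookupD (p ∷ ps) (suc i) = lookupD ps i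

lookupM : List ℕ → ℕ → Maybe ℕ
lookupM []       _       = nothing
lookupM (k ∷ ks) zero    = just k
lookupM (k ∷ ks) (suc i) = lookupM ks i

-- C is a formula whose resource indices 0..n-1 are the parameters
-- x_1..x_n, and whose index n+k is the ambient free variable k.
-- d = number of resource binders passed, e = number of atom binders passed.

instSub : ℕ → List Poly → ℕ → ℕ → Poly
instSub n ps d j = if j <ᵇ n then lookupD ps j else var (d + (j ∸ n))

substAt : Form → ℕ → ℕ → ℕ → ℕ → Form → Form
substAt F n α d e (at a ps)  =
  if a ≡ᵇ (e + α) then fsub (instSub n ps d) (aren (e +_) F) else at a ps
substAt F n α d e (A ⊗ B)    = substAt F n α d e A ⊗ substAt F n α d e B
substAt F n α d e (A ⊸ B)    = substAt F n α d e A ⊸ substAt F n α d e B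
substAt F n α d e (all k A)  = all k (substAt F n α d (suc e) A)
substAt F n α d e (bang p A) = bang p (substAt F n α (suc d) e A)
substAt F n α d e (fa m Φ A) = fa m Φ (substAt F n α (m + d) e A)
substAt F n α d e (ex m Φ A) = ex m Φ (substAt F n α (m + d) e A)

_[_/_,_] : Form → Form → ℕ → ℕ → Form
A [ F / α , n ] = substAt F n α 0 0 A

-- Polarity.  NoOcc s x A : the resource variable x has no occurrence of
-- polarity s in A.

data Pol : Set where
  pos neg : Pol

flip : Pol → Pol
flip pos = neg
flip neg = pos

NoOccP : Pol → ℕ → Poly → Set
NoOccP pos x p = ¬ Free x p
NoOccP neg x p = ⊤

NoOccC : Pol → ℕ → Constraint → Set
NoOccC s x (p ≤ᶜ q) = NoOccP (flip s) x p × NoOccP s x q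

NoOcc : Pol → ℕ → Form → Set
NoOcc s x (at a ps)  = All (NoOccP s x) ps
NoOcc s x (A ⊗ B)    = NoOcc s x A × NoOcc s x B
NoOcc s x (A ⊸ B)    = NoOcc (flip s) x A × NoOcc s x B
NoOcc s x (all k A)  = NoOcc s x A
NoOcc s x (bang p A) = NoOccP (flip s) x p × NoOcc s (suc x) A
NoOcc s x (fa m Φ A) = All (NoOccC (flip s) (m + x)) Φ × NoOcc s (m + x) A
NoOcc s x (ex m Φ A) = All (NoOccC s (m + x)) Φ × NoOcc s (m + x) A

OnlyPos : ℕ → Form → Set
OnlyPos x A = NoOcc neg x A

-- Well-formedness: atom arities (Γ lists the arities of the free atoms),
-- all polynomials are resource polynomials, boundedness of quantifiers.

Bounded : ℕ → CSet → Set
Bounded m Φ = ∀ i → suc i ≤ m →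
  Σ Poly λ r → IsRP r × (Φ ⊨ (var i ≤ᶜ pshift m r))

WF : List ℕ → Form → Set
WF Γ (at a ps)  = lookupM Γ a ≡ just (length ps) × All IsRP ps
WF Γ (A ⊗ B)    = WF Γ A × WF Γ B
WF Γ (A ⊸ B)    = WF Γ A × WF Γ B
WF Γ (all k A)  = WF (k ∷ Γ) A
WF Γ (bang p A) = IsRP p × WF Γ A
WF Γ (fa m Φ A) = All RPc Φ × Bounded m Φ × WF Γ A
WF Γ (ex m Φ A) = All RPc Φ × Bounded m Φ × WF Γ A

_≤[_]_ : Form → CSet → Form → Set
at a ps ≤[ Φ ] at b qs = a ≡ b × Pointwise (λ p q → p ⊑[ Φ ] q) ps qs
(A ⊗ B) ≤[ Φ ] (E ⊗ D) = A ≤[ Φ ] E × B ≤[ Φ ] D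
(A ⊸ B) ≤[ Φ ] (E ⊸ D) = E ≤[ Φ ] A × B ≤[ Φ ] D
all k A ≤[ Φ ] all l B = k ≡ l × A ≤[ Φ ] B
bang p A ≤[ Φ ] bang q B =
  q ⊑[ Φ ] p × A ≤[ (var 0 <ᶜ pshift 1 q) ∷ cshift 1 Φ ] B
fa m Ψ A ≤[ Φ ] fa l Θ B =
  m ≡ l × (cshift m Φ ++ Θ) ⊨* Ψ × A ≤[ cshift m Φ ++ Θ ] B
ex m Ψ A ≤[ Φ ] ex l Θ B =
  m ≡ l × (cshift m Φ ++ Ψ) ⊨* Θ × A ≤[ cshift m Φ ++ Ψ ] B
_ ≤[ _ ] _ = ⊥

-- Substituting C for α replaces each atom α(ps) by the instance of C at the
-- parameters ps, and α(ps) ≤_Φ α(qs) says ps ⊑_Φ qs pointwise.  So the theorem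
-- reduces to monotonicity of resource substitution: if σ ⊑_Φ τ at every variable
-- occurring positively in F and τ ⊑_Φ σ at every variable occurring negatively,
-- then F σ ≤_Φ F τ.  This is proved by induction on F, swapping σ and τ whenever
-- the polarity flips and shifting the substitutions under binders; as the
-- parameters of C occur only positively, the instances at ps and qs qualify.
module Submission where

open import Defs
open import Data.Nat using (ℕ; _<_; suc; _+_; _*_; _∸_; _≤_; _<ᵇ_; _≡ᵇ_; z≤n; _≤′_; ≤′-refl; ≤′-step)
open import Data.Nat.Properties
open import Data.Nat.Combinatorics using (nCk+nC[k+1]≡[n+1]C[k+1]) renaming (_C_ to _choose_)
open import Data.List using (List; []; _∷_; map; _++_)
open import Data.List.Relation.Unary.All using (All; []; _∷_)
import Data.List.Relation.Unary.All as All
open import Data.List.Relation.Unary.All.Properties using (map⁻; ++⁻ˡ; ++⁻ʳ)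
open import Data.List.Relation.Binary.Pointwise using (Pointwise; []; _∷_)
open import Data.Maybe using (just)
open import Data.Bool using (true; false; T)
open import Data.Unit using (tt)
open import Data.Product using (_×_; _,_; proj₁; proj₂)
open import Data.Sum using (_⊎_; inj₁; inj₂; map₁)
open import Function using (_∘_)
open import Relation.Nullary using (¬_; contradiction)
open import Relation.Binary.PropositionalEquality

nCk≤[n+1]Ck : ∀ n k → n choose k ≤ suc n choose k
nCk≤[n+1]Ck n 0       = ≤-refl
nCk≤[n+1]Ck n (suc k) =
  subst (n choose suc k ≤_) (nCk+nC[k+1]≡[n+1]C[k+1] n k) (m≤n+m _ _)

choose-monoˡ-≤ : ∀ {m n} k → m ≤ n → m choose k ≤ n choose k
choose-monoˡ-≤ k m≤n = go (≤⇒≤′ m≤n)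
  where
  go : ∀ {m n} → m ≤′ n → m choose k ≤ n choose k
  go ≤′-refl        = ≤-refl
  go (≤′-step m≤′n) = ≤-trans (go m≤′n) (nCk≤[n+1]Ck _ k)

eval-psub : ∀ ρ σ p → eval ρ (psub σ p) ≡ eval (λ j → eval ρ (σ j)) p
eval-psub ρ σ (var x)   = refl
eval-psub ρ σ 𝟘         = refl
eval-psub ρ σ 𝟙         = refl
eval-psub ρ σ (p ⊕ q)   = cong₂ _+_ (eval-psub ρ σ p) (eval-psub ρ σ q)
eval-psub ρ σ (p ⊛ q)   = cong₂ _*_ (eval-psub ρ σ p) (eval-psub ρ σ q)
eval-psub ρ σ (bin p k) = cong (_choose k) (eval-psub ρ σ p)

eval-mono : ∀ {ρ ρ′} p → (∀ j → Free j p → ρ j ≤ ρ′ j) → eval ρ p ≤ eval ρ′ p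
eval-mono (var x)   ρ≤ρ′ = ρ≤ρ′ x refl
eval-mono 𝟘         ρ≤ρ′ = z≤n
eval-mono 𝟙         ρ≤ρ′ = ≤-refl
eval-mono (p ⊕ q)   ρ≤ρ′ = +-mono-≤ (eval-mono p (λ j → ρ≤ρ′ j ∘ inj₁)) (eval-mono q (λ j → ρ≤ρ′ j ∘ inj₂))
eval-mono (p ⊛ q)   ρ≤ρ′ = *-mono-≤ (eval-mono p (λ j → ρ≤ρ′ j ∘ inj₁)) (eval-mono q (λ j → ρ≤ρ′ j ∘ inj₂))
eval-mono (bin p k) ρ≤ρ′ = choose-monoˡ-≤ k (eval-mono p ρ≤ρ′)

Sat-csub⁻ : ∀ ρ σ c → Sat ρ (csub σ c) → Sat (λ j → eval ρ (σ j)) c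
Sat-csub⁻ ρ σ (p ≤ᶜ q) = subst₂ _≤_ (eval-psub ρ σ p) (eval-psub ρ σ q)

All-Sat-csetsub⁻ : ∀ {ρ σ Ψ} → All (Sat ρ) (csetsub σ Ψ) → All (Sat (λ j → eval ρ (σ j))) Ψ
All-Sat-csetsub⁻ {ρ} {σ} = All.map (λ {c} → Sat-csub⁻ ρ σ c) ∘ map⁻

⊨*-intro : ∀ {Φ Ψ} → (∀ ρ → All (Sat ρ) Φ → All (Sat ρ) Ψ) → Φ ⊨* Ψ
⊨*-intro Φ⇒Ψ = All.tabulate (λ c∈Ψ ρ ρ⊨Φ → All.lookup (Φ⇒Ψ ρ ρ⊨Φ) c∈Ψ)

⊑-refl : ∀ {Φ p} → p ⊑[ Φ ] p
⊑-refl _ _ = ≤-refl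

psub-⊑ : ∀ {Φ Φ′ σ p q} → (∀ ρ → All (Sat ρ) Φ′ → All (Sat ρ) (csetsub σ Φ)) →
         p ⊑[ Φ ] q → psub σ p ⊑[ Φ′ ] psub σ q
psub-⊑ {σ = σ} {p} {q} Φ′⇒Φσ p⊑q ρ ρ⊨Φ′ =
  subst₂ _≤_ (sym (eval-psub ρ σ p)) (sym (eval-psub ρ σ q))
    (p⊑q _ (All-Sat-csetsub⁻ (Φ′⇒Φσ ρ ρ⊨Φ′)))

record SubstLe (Φ : CSet) (P : ℕ → Set) (σ τ : ℕ → Poly) : Set where
  constructor pointwise
  field apply : ∀ j → P j ⊎ σ j ⊑[ Φ ] τ j
open SubstLe

-- With P j, N j := "j has no positive/negative occurrence": σ ⊑ τ at the
-- variables occurring positively and τ ⊑ σ at those occurring negatively.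
record MonoSubst (Φ : CSet) (P N : ℕ → Set) (σ τ : ℕ → Poly) : Set where
  constructor _,_
  field
    below : SubstLe Φ P σ τ
    above : SubstLe Φ N τ σ
open MonoSubst

SubstLe-map : ∀ {Φ P Q σ τ} → (∀ {j} → P j → Q j) → SubstLe Φ P σ τ → SubstLe Φ Q σ τ
SubstLe-map P⇒Q σ≤τ = pointwise λ j → map₁ P⇒Q (apply σ≤τ j)

MonoSubst-map : ∀ {Φ P N P′ N′ σ τ} → (∀ {j} → P j → P′ j) → (∀ {j} → N j → N′ j) →
                MonoSubst Φ P N σ τ → MonoSubst Φ P′ N′ σ τ
MonoSubst-map P⇒P′ N⇒N′ (σ≤τ , τ≤σ) = SubstLe-map P⇒P′ σ≤τ , SubstLe-map N⇒N′ τ≤σ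

MonoSubst-swap : ∀ {Φ P N σ τ} → MonoSubst Φ P N σ τ → MonoSubst Φ N P τ σ
MonoSubst-swap (σ≤τ , τ≤σ) = τ≤σ , σ≤τ

SubstLe-lift : ∀ m {Φ Φ′ P Q σ τ} → (∀ ρ → All (Sat ρ) Φ′ → All (Sat ρ) (cshift m Φ)) →
               (∀ {k} → P k → Q (m + k)) → SubstLe Φ P σ τ → SubstLe Φ′ Q (lift m σ) (lift m τ)
SubstLe-lift m {Φ′ = Φ′} {Q = Q} {σ} {τ} Φ′⇒Φ P⇒Q σ≤τ = pointwise lifted
  where
  lifted : ∀ j → Q j ⊎ lift m σ j ⊑[ Φ′ ] lift m τ j
  lifted j with j <ᵇ m in j<ᵇm
  ... | true  = inj₂ (⊑-refl {p = var j})
  ... | false with apply σ≤τ (j ∸ m)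
  ...   | inj₁ Pk   = inj₁ (subst Q (m+[n∸m]≡n m≤j) (P⇒Q Pk))
    where
    m≤j : m ≤ j
    m≤j = ≮⇒≥ (λ j<m → subst T j<ᵇm (<⇒<ᵇ j<m))
  ...   | inj₂ σ≤τₖ = inj₂ (psub-⊑ {p = σ (j ∸ m)} {τ (j ∸ m)} Φ′⇒Φ σ≤τₖ)

MonoSubst-lift : ∀ m {Φ Φ′ P N P′ N′ σ τ} → (∀ ρ → All (Sat ρ) Φ′ → All (Sat ρ) (cshift m Φ)) →
                 (∀ {k} → P k → P′ (m + k)) → (∀ {k} → N k → N′ (m + k)) →
                 MonoSubst Φ P N σ τ → MonoSubst Φ′ P′ N′ (lift m σ) (lift m τ)
MonoSubst-lift m Φ′⇒Φ P⇒P′ N⇒N′ (σ≤τ , τ≤σ) =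
  SubstLe-lift m Φ′⇒Φ P⇒P′ σ≤τ , SubstLe-lift m Φ′⇒Φ N⇒N′ τ≤σ

psub-mono : ∀ {Φ σ τ} p → SubstLe Φ (λ j → ¬ Free j p) σ τ → psub σ p ⊑[ Φ ] psub τ p
psub-mono {σ = σ} {τ} p σ≤τ ρ ρ⊨Φ =
  subst₂ _≤_ (sym (eval-psub ρ σ p)) (sym (eval-psub ρ τ p)) (eval-mono p σ≤τ-on-p)
  where
  σ≤τ-on-p : ∀ j → Free j p → eval ρ (σ j) ≤ eval ρ (τ j)
  σ≤τ-on-p j j∈p with apply σ≤τ j
  ... | inj₁ j∉p  = contradiction j∈p j∉p
  ... | inj₂ σ≤τⱼ = σ≤τⱼ ρ ρ⊨Φ

map-psub-mono : ∀ {Φ σ τ} ps → SubstLe Φ (λ j → All (λ p → ¬ Free j p) ps) σ τ →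
                Pointwise (λ p q → p ⊑[ Φ ] q) (map (psub σ) ps) (map (psub τ) ps)
map-psub-mono []       σ≤τ = []
map-psub-mono (p ∷ ps) σ≤τ =
  psub-mono p (SubstLe-map All.head σ≤τ) ∷ map-psub-mono ps (SubstLe-map All.tail σ≤τ)

Sat-csub-mono : ∀ {Φ σ τ ρ} c → MonoSubst Φ (λ j → NoOccC pos j c) (λ j → NoOccC neg j c) σ τ →
                All (Sat ρ) Φ → Sat ρ (csub σ c) → Sat ρ (csub τ c)
Sat-csub-mono (p ≤ᶜ q) (σ≤τ , τ≤σ) ρ⊨Φ σp≤σq =
  ≤-trans (psub-mono p (SubstLe-map proj₁ τ≤σ) _ ρ⊨Φ)
    (≤-trans σp≤σq (psub-mono q (SubstLe-map proj₂ σ≤τ) _ ρ⊨Φ))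

All-Sat-csetsub-mono : ∀ {Φ σ τ ρ} Ψ →
                       MonoSubst Φ (λ j → All (NoOccC pos j) Ψ) (λ j → All (NoOccC neg j) Ψ) σ τ →
                       All (Sat ρ) Φ → All (Sat ρ) (csetsub σ Ψ) → All (Sat ρ) (csetsub τ Ψ)
All-Sat-csetsub-mono []      H ρ⊨Φ []          = []
All-Sat-csetsub-mono (c ∷ Ψ) H ρ⊨Φ (ρ⊨c ∷ ρ⊨Ψ) =
  Sat-csub-mono c (MonoSubst-map All.head All.head H) ρ⊨Φ ρ⊨c ∷
  All-Sat-csetsub-mono Ψ (MonoSubst-map All.tail All.tail H) ρ⊨Φ ρ⊨Ψ

csetsub-mono : ∀ {σ τ} Θ Ψ →
               MonoSubst (Θ ++ csetsub σ Ψ) (λ j → All (NoOccC pos j) Ψ) (λ j → All (NoOccC neg j) Ψ) σ τ →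
               (Θ ++ csetsub σ Ψ) ⊨* csetsub τ Ψ
csetsub-mono Θ Ψ H = ⊨*-intro (λ ρ ρ⊨ΘΨ → All-Sat-csetsub-mono Ψ H ρ⊨ΘΨ (++⁻ʳ Θ ρ⊨ΘΨ))

fsub-mono : ∀ {Φ σ τ} F → MonoSubst Φ (λ j → NoOcc pos j F) (λ j → NoOcc neg j F) σ τ →
            fsub σ F ≤[ Φ ] fsub τ F
fsub-mono (at a ps) H = refl , map-psub-mono ps (below H)
fsub-mono (A ⊗ B)   H = fsub-mono A (MonoSubst-map proj₁ proj₁ H) , fsub-mono B (MonoSubst-map proj₂ proj₂ H)
fsub-mono (A ⊸ B)   H =
  fsub-mono A (MonoSubst-swap (MonoSubst-map proj₁ proj₁ H)) , fsub-mono B (MonoSubst-map proj₂ proj₂ H)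
fsub-mono (all k A) H = refl , fsub-mono A H
fsub-mono (bang p A) H =
  psub-mono p (SubstLe-map proj₁ (above H)) ,
  fsub-mono A (MonoSubst-lift 1 (λ _ → All.tail) proj₂ proj₂ H)
fsub-mono {Φ} (fa m Ψ A) H =
  refl , csetsub-mono (cshift m Φ) Ψ (MonoSubst-swap (MonoSubst-map proj₁ proj₁ H′)) ,
  fsub-mono A (MonoSubst-map proj₂ proj₂ H′)
  where H′ = MonoSubst-lift m (λ _ → ++⁻ˡ (cshift m Φ)) (λ h → h) (λ h → h) H
fsub-mono {Φ} (ex m Ψ A) H =
  refl , csetsub-mono (cshift m Φ) Ψ (MonoSubst-map proj₁ proj₁ H′) ,
  fsub-mono A (MonoSubst-map proj₂ proj₂ H′)
  where H′ = MonoSubst-lift m (λ _ → ++⁻ˡ (cshift m Φ)) (λ h → h) (λ h → h) H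

NoOcc-aren : ∀ {s x} ρ A → NoOcc s x A → NoOcc s x (aren ρ A)
NoOcc-aren ρ (at a ps)  h          = h
NoOcc-aren ρ (A ⊗ B)    (hA , hB)  = NoOcc-aren ρ A hA , NoOcc-aren ρ B hB
NoOcc-aren ρ (A ⊸ B)    (hA , hB)  = NoOcc-aren ρ A hA , NoOcc-aren ρ B hB
NoOcc-aren ρ (all k A)  h          = NoOcc-aren (aext ρ) A h
NoOcc-aren ρ (bang p A) (hp , hA)  = hp , NoOcc-aren ρ A hA
NoOcc-aren ρ (fa m Φ A) (hΦ , hA)  = hΦ , NoOcc-aren ρ A hA
NoOcc-aren ρ (ex m Φ A) (hΦ , hA)  = hΦ , NoOcc-aren ρ A hA

lookupD-⊑ : ∀ {Φ ps qs} → Pointwise (λ p q → p ⊑[ Φ ] q) ps qs → ∀ j → lookupD ps j ⊑[ Φ ] lookupD qs j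
lookupD-⊑ []            j       = ⊑-refl {p = 𝟘}
lookupD-⊑ (p⊑q ∷ _)     0       = p⊑q
lookupD-⊑ (_ ∷ ps⊑qs)   (suc j) = lookupD-⊑ ps⊑qs j

instSub-mono : ∀ {Φ ps qs} n d F → (∀ i → i < n → OnlyPos i F) →
               Pointwise (λ p q → p ⊑[ Φ ] q) ps qs →
               MonoSubst Φ (λ j → NoOcc pos j F) (λ j → NoOcc neg j F) (instSub n ps d) (instSub n qs d)
instSub-mono {Φ} {ps} {qs} n d F onlyPos ps⊑qs = pointwise below′ , pointwise above′
  where
  below′ : ∀ j → NoOcc pos j F ⊎ instSub n ps d j ⊑[ Φ ] instSub n qs d j
  below′ j with j <ᵇ n
  ... | true  = inj₂ (lookupD-⊑ ps⊑qs j)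
  ... | false = inj₂ (⊑-refl {p = var (d + (j ∸ n))})
  above′ : ∀ j → NoOcc neg j F ⊎ instSub n qs d j ⊑[ Φ ] instSub n ps d j
  above′ j with j <ᵇ n in j<ᵇn
  ... | true  = inj₁ (onlyPos j (<ᵇ⇒< j n (subst T (sym j<ᵇn) tt)))
  ... | false = inj₂ (⊑-refl {p = var (d + (j ∸ n))})

module _ {C : Form} {n α : ℕ} (onlyPos : ∀ i → i < n → OnlyPos i C) where

  substAt-mono : ∀ d e {Φ} A B → A ≤[ Φ ] B → substAt C n α d e A ≤[ Φ ] substAt C n α d e B
  substAt-mono d e (at a ps) (at .a qs) (refl , ps⊑qs) with a ≡ᵇ (e + α)
  ... | true  = fsub-mono C′ (instSub-mono n d C′ (λ i i<n → NoOcc-aren (e +_) C (onlyPos i i<n)) ps⊑qs)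
    where C′ = aren (e +_) C
  ... | false = refl , ps⊑qs
  substAt-mono d e (A ⊗ B)    (A′ ⊗ B′)    (A≤A′ , B≤B′) = substAt-mono d e A A′ A≤A′ , substAt-mono d e B B′ B≤B′
  substAt-mono d e (A ⊸ B)    (A′ ⊸ B′)    (A′≤A , B≤B′) = substAt-mono d e A′ A A′≤A , substAt-mono d e B B′ B≤B′
  substAt-mono d e (all k A)  (all l B)    (k≡l , A≤B)   = k≡l , substAt-mono d (suc e) A B A≤B
  substAt-mono d e (bang p A) (bang q B)   (q⊑p , A≤B)   = q⊑p , substAt-mono (suc d) e A B A≤B
  substAt-mono d e (fa m Ψ A) (fa .m Θ B)  (refl , Θ⊨Ψ , A≤B) = refl , Θ⊨Ψ , substAt-mono (m + d) e A B A≤B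
  substAt-mono d e (ex m Ψ A) (ex .m Θ B)  (refl , Ψ⊨Θ , A≤B) = refl , Ψ⊨Θ , substAt-mono (m + d) e A B A≤B
  substAt-mono d e (at _ _)   (_ ⊗ _)    ()
  substAt-mono d e (at _ _)   (_ ⊸ _)    ()
  substAt-mono d e (at _ _)   (all _ _)  ()
  substAt-mono d e (at _ _)   (bang _ _) ()
  substAt-mono d e (at _ _)   (fa _ _ _) ()
  substAt-mono d e (at _ _)   (ex _ _ _) ()
  substAt-mono d e (_ ⊗ _)    (at _ _)   ()
  substAt-mono d e (_ ⊗ _)    (_ ⊸ _)    ()
  substAt-mono d e (_ ⊗ _)    (all _ _)  ()
  substAt-mono d e (_ ⊗ _)    (bang _ _) ()
  substAt-mono d e (_ ⊗ _)    (fa _ _ _) ()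
  substAt-mono d e (_ ⊗ _)    (ex _ _ _) ()
  substAt-mono d e (_ ⊸ _)    (at _ _)   ()
  substAt-mono d e (_ ⊸ _)    (_ ⊗ _)    ()
  substAt-mono d e (_ ⊸ _)    (all _ _)  ()
  substAt-mono d e (_ ⊸ _)    (bang _ _) ()
  substAt-mono d e (_ ⊸ _)    (fa _ _ _) ()
  substAt-mono d e (_ ⊸ _)    (ex _ _ _) ()
  substAt-mono d e (all _ _)  (at _ _)   ()
  substAt-mono d e (all _ _)  (_ ⊗ _)    ()
  substAt-mono d e (all _ _)  (_ ⊸ _)    ()
  substAt-mono d e (all _ _)  (bang _ _) ()
  substAt-mono d e (all _ _)  (fa _ _ _) ()
  substAt-mono d e (all _ _)  (ex _ _ _) ()
  substAt-mono d e (bang _ _) (at _ _)   ()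
  substAt-mono d e (bang _ _) (_ ⊗ _)    ()
  substAt-mono d e (bang _ _) (_ ⊸ _)    ()
  substAt-mono d e (bang _ _) (all _ _)  ()
  substAt-mono d e (bang _ _) (fa _ _ _) ()
  substAt-mono d e (bang _ _) (ex _ _ _) ()
  substAt-mono d e (fa _ _ _) (at _ _)   ()
  substAt-mono d e (fa _ _ _) (_ ⊗ _)    ()
  substAt-mono d e (fa _ _ _) (_ ⊸ _)    ()
  substAt-mono d e (fa _ _ _) (all _ _)  ()
  substAt-mono d e (fa _ _ _) (bang _ _) ()
  substAt-mono d e (fa _ _ _) (ex _ _ _) ()
  substAt-mono d e (ex _ _ _) (at _ _)   ()
  substAt-mono d e (ex _ _ _) (_ ⊗ _)    ()
  substAt-mono d e (ex _ _ _) (_ ⊸ _)    ()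
  substAt-mono d e (ex _ _ _) (all _ _)  ()
  substAt-mono d e (ex _ _ _) (bang _ _) ()
  substAt-mono d e (ex _ _ _) (fa _ _ _) ()

lemma2p12 : (Γ : List ℕ) (α n : ℕ) (C A B : Form) (Φ : CSet) →
    lookupM Γ α ≡ just n →
    WF Γ C → (∀ i → i < n → OnlyPos i C) →
    WF Γ A → WF Γ B → All RPc Φ →
    A ≤[ Φ ] B →
    (A [ C / α , n ]) ≤[ Φ ] (B [ C / α , n ])
lemma2p12 Γ α n C A B Φ _ _ onlyPos _ _ _ = substAt-mono onlyPos 0 0 A B
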